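{- Let $\mathbf c=(c_1,\ldots,c_{n+1})$ and $\mathbf a=(a_1,\ldots,a_{n+1},-\sum_i a_i)$ with $a_i,c_i\in\mathbb{Z}_{\ge0}$. The Ehrhart polynomial of $\mathcal{F}_{\Pi_{n+1}(\mathbf c)}(\mathbf a)$, i.e. the polynomial $t\mapsto K_{\Pi_{n+1}(\mathbf c)}(t\mathbf a)$, has positive coefficients.
   Context: $\Pi_{n+1}(\mathbf c)$ is the multigraph on $[n+2]$ consisting of edges $(i,i+1)$, $i=1,\ldots,n+1$, together with $c_i$ copies of $(i,n+2)$ for each $i\in[n+1]$. $\mathcal{F}_G(\mathbf a)$ is the set of nonnegative real edge flows with (outflow minus inflow) at vertex $i$ equal to $a_i$ for $i\in[n+1]$; $K_G(\mathbf a)$ is its number of integer points. -}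

module Defs where

open import Data.Nat using (ℕ; zero; suc; _*_)
open import Data.Fin using (Fin; inject₁; fromℕ; _≟_)
import Data.Fin
open import Data.Integer as ℤ using (ℤ; +_)
open import Data.Rational as ℚ using (ℚ; 0ℚ)
open import Data.Product using (_×_; _,_)
open import Data.List using (List; []; _∷_; _++_; map; concatMap; replicate; allFin; length)
open import Data.Vec as Vec using (Vec; []; _∷_; tabulate; lookup)
open import Data.Bool using (if_then_else_)
open import Relation.Nullary.Decidable using (⌊_⌋)
open import Relation.Binary.PropositionalEquality using (_≡_)
open import Function.Bundles using (_↔_)

-- A directed multigraph on vertex set Fin v is a list of edges (tail , head).
Multigraph : ℕ → Set
Multigraph v = List (Fin v × Fin v)

-- Π_{n+1}(c) on vertices Fin (n+2) (vertex k here = vertex k+1 in the paper):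
-- path edges (i , i+1) for i = 0..n, and c_i copies of (i , n+1) for i = 0..n.
Π : (n : ℕ) → Vec ℕ (suc n) → Multigraph (suc (suc n))
Π n c =
  map (λ i → (inject₁ i , Data.Fin.suc i)) (allFin (suc n))
  ++ concatMap (λ i → replicate (lookup c i) (inject₁ i , fromℕ (suc n))) (allFin (suc n))


netflow : ∀ {v} (E : Multigraph v) → Vec ℕ (length E) → Fin v → ℤ
netflow [] [] w = + 0
netflow ((s , h) ∷ E) (x ∷ f) w =
  ((if ⌊ s ≟ w ⌋ then + x else + 0) ℤ.- (if ⌊ h ≟ w ⌋ then + x else + 0))
  ℤ.+ netflow E f w

IntegerFlow : (n : ℕ) → Multigraph (suc (suc n)) → Vec ℕ (suc n) → Set
IntegerFlow n G a =
  Data.Product.Σ (Vec ℕ (length G)) λ f →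
    tabulate (λ i → netflow G f (inject₁ i)) ≡ Vec.map +_ a

HasCard : Set → ℕ → Set
HasCard A m = A ↔ Fin m

scale : ∀ {k} → ℕ → Vec ℕ k → Vec ℕ k
scale t a = Vec.map (t *_) a

evalPoly : List ℚ → ℚ → ℚ
evalPoly [] x = 0ℚ
evalPoly (p ∷ ps) x = p ℚ.+ x ℚ.* evalPoly ps x

ℕtoℚ : ℕ → ℚ
ℕtoℚ m = ℤ.+ m ℚ./ 1

-- Split off the first vertex of Π: a flow is the amount x sent along the first path edge, a
-- composition of a₁ - x into c₁ parts on the sink edges, and a flow on the smaller graph whose first
-- vertex receives x extra units. So the number of integer flows is an iterated convolution of the
-- composition counts C(w + c - 1, c - 1). Expanding inductively along the path,
--   K(t a) = ∑_{l ≤ D} β_l(t) · C(t a₁ + c₁ + l, c₁ + l),   D = c₂ + … + c_{n+1},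
-- where each weight β_l is a polynomial in t with nonnegative coefficients and degree at most D - l
-- (a sum of products of the polynomials C(t aᵢ + r - 1, r) = ∏_{k<r} (t aᵢ + k)/(k + 1)), and β_D = 1.
-- If a₁ > 0, then C(t a₁ + m, m) = ∏_{k<m} (t a₁ + k + 1)/(k + 1) has positive coefficients in every
-- degree up to m, so the term l = D has positive coefficients in every degree up to c₁ + D, which
-- bounds the degrees of all other terms. A leading vertex with a₁ = 0 can simply be dropped.

module Submission where

open import Defs
open import Data.Nat as ℕ using (ℕ; zero; suc; _+_; _*_; _∸_; _⊔_; _≤_; z≤n; s≤s)
import Data.Nat.Properties as ℕₚ
import Data.Nat.Coprimality as Coprime
open import Data.Integer as ℤ using (ℤ; +_)
import Data.Integer.Properties as ℤₚ
open import Data.Rational as ℚ using (ℚ; 0ℚ; 1ℚ; mkℚ; _<_)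
import Data.Rational.Properties as ℚₚ
import Data.Rational.Solver as ℚ-Solver
import Data.Integer.Solver as ℤ-Solver
open import Algebra.Properties.CommutativeSemigroup ℕₚ.+-commutativeSemigroup
  using () renaming (interchange to +-interchange; x∙yz≈y∙xz to x+[y+z]≡y+[x+z])
open import Algebra.Properties.CommutativeSemigroup ℕₚ.*-commutativeSemigroup
  using () renaming (x∙yz≈y∙xz to x*[y*z]≡y*[x*z])
open import Data.Fin as Fin using (Fin; zero; suc; inject₁; _≟_)
import Data.Fin.Properties as Finₚ
open import Data.Bool using (if_then_else_)
open import Data.Empty using (⊥-elim)
open import Data.Unit using (⊤; tt)
open import Data.Product as Product using (Σ; _×_; _,_; proj₁; proj₂)
open import Data.Product.Function.NonDependent.Propositional using (_×-↔_)
open import Data.Product.Function.Dependent.Propositional using (Σ-↔)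
open import Data.Sum using (_⊎_; inj₁; inj₂)
open import Data.Sum.Function.Propositional using (_⊎-↔_)
open import Data.List using (List; []; _∷_; _++_; map; replicate; concat; concatMap; tabulate; allFin; length)
import Data.List.Properties as Listₚ
open import Data.List.Relation.Unary.All as All using (All; []; _∷_)
open import Data.Vec as Vec using (Vec; []; _∷_; sum; cast)
import Data.Vec.Properties as Vecₚ
open import Function.Bundles using (_↔_; mk↔ₛ′; Inverse)
open import Function.Properties.Inverse using (↔-refl; ↔-trans; ↔-sym)
open import Axiom.UniquenessOfIdentityProofs using (module Decidable⇒UIP)
open import Relation.Binary.PropositionalEquality
open import Relation.Nullary using (Irrelevant; yes; no)
open import Relation.Nullary.Decidable using (⌊_⌋)

-- Finite sums, convolutions and compositions

∑ : ℕ → (ℕ → ℕ) → ℕ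
∑ zero f = 0
∑ (suc N) f = f 0 + ∑ N (λ j → f (suc j))

∑-cong : ∀ N {f g} → (∀ j → j ℕ.< N → f j ≡ g j) → ∑ N f ≡ ∑ N g
∑-cong zero h = refl
∑-cong (suc N) h = cong₂ _+_ (h 0 (s≤s z≤n)) (∑-cong N (λ j j<N → h (suc j) (s≤s j<N)))

∑-zero : ∀ N → ∑ N (λ _ → 0) ≡ 0
∑-zero zero = refl
∑-zero (suc N) = ∑-zero N

∑-+ : ∀ N f g → ∑ N (λ j → f j + g j) ≡ ∑ N f + ∑ N g
∑-+ zero f g = refl
∑-+ (suc N) f g = trans (cong (_+_ (f 0 + g 0)) (∑-+ N (λ j → f (suc j)) (λ j → g (suc j))))
  (+-interchange (f 0) (g 0) _ _)

∑-*ˡ : ∀ N k f → ∑ N (λ j → k * f j) ≡ k * ∑ N f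
∑-*ˡ zero k f = sym (ℕₚ.*-zeroʳ k)
∑-*ˡ (suc N) k f = trans (cong (_+_ (k * f 0)) (∑-*ˡ N k (λ j → f (suc j)))) (sym (ℕₚ.*-distribˡ-+ k (f 0) _))

∑-comm : ∀ N L (f : ℕ → ℕ → ℕ) → ∑ N (λ i → ∑ L (f i)) ≡ ∑ L (λ j → ∑ N (λ i → f i j))
∑-comm zero L f = sym (∑-zero L)
∑-comm (suc N) L f = trans (cong (_+_ (∑ L (f 0))) (∑-comm N L (λ i → f (suc i))))
  (sym (∑-+ L (f 0) (λ j → ∑ N (λ i → f (suc i) j))))

∑-*ʳ : ∀ N k f → ∑ N (λ j → f j * k) ≡ ∑ N f * k
∑-*ʳ zero k f = refl
∑-*ʳ (suc N) k f = trans (cong (_+_ (f 0 * k)) (∑-*ʳ N k (λ j → f (suc j)))) (sym (ℕₚ.*-distribʳ-+ k (f 0) _))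

∑-*-∑ : ∀ N L (w : ℕ → ℕ) (S : ℕ → ℕ → ℕ) (e : ℕ → ℕ) →
  ∑ N (λ j → w j * ∑ L (λ l → S j l * e l)) ≡ ∑ L (λ l → ∑ N (λ j → w j * S j l) * e l)
∑-*-∑ N L w S e = begin
  ∑ N (λ j → w j * ∑ L (λ l → S j l * e l))
    ≡⟨ ∑-cong N (λ j _ → trans (sym (∑-*ˡ L (w j) (λ l → S j l * e l))) (∑-cong L (λ l _ → sym (ℕₚ.*-assoc (w j) (S j l) (e l))))) ⟩
  ∑ N (λ j → ∑ L (λ l → w j * S j l * e l))  ≡⟨ ∑-comm N L (λ j l → w j * S j l * e l) ⟩
  ∑ L (λ l → ∑ N (λ j → w j * S j l * e l))  ≡⟨ ∑-cong L (λ l _ → ∑-*ʳ N (e l) (λ j → w j * S j l)) ⟩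
  ∑ L (λ l → ∑ N (λ j → w j * S j l) * e l) ∎
  where open ≡-Reasoning

-- conv f g M = ∑_{w + v = M} f w * g v
conv : (ℕ → ℕ) → (ℕ → ℕ) → ℕ → ℕ
conv f g zero = f 0 * g 0
conv f g (suc M) = f (suc M) * g 0 + conv f (λ v → g (suc v)) M

conv-cong : ∀ M {f f′ g g′} → (∀ x → f x ≡ f′ x) → (∀ x → g x ≡ g′ x) → conv f g M ≡ conv f′ g′ M
conv-cong zero hf hg = cong₂ _*_ (hf 0) (hg 0)
conv-cong (suc M) hf hg = cong₂ _+_ (cong₂ _*_ (hf (suc M)) (hg 0)) (conv-cong M hf (λ x → hg (suc x)))

conv-zeroʳ : ∀ M f → conv f (λ _ → 0) M ≡ 0
conv-zeroʳ zero f = ℕₚ.*-zeroʳ (f 0)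
conv-zeroʳ (suc M) f rewrite ℕₚ.*-zeroʳ (f (suc M)) = conv-zeroʳ M f

conv-+ʳ : ∀ M f g h → conv f (λ v → g v + h v) M ≡ conv f g M + conv f h M
conv-+ʳ zero f g h = ℕₚ.*-distribˡ-+ (f 0) (g 0) (h 0)
conv-+ʳ (suc M) f g h =
  trans (cong₂ _+_ (ℕₚ.*-distribˡ-+ (f (suc M)) (g 0) (h 0)) (conv-+ʳ M f (λ v → g (suc v)) (λ v → h (suc v))))
    (+-interchange (f (suc M) * g 0) (f (suc M) * h 0) _ _)

conv-*ʳ : ∀ M f k g → conv f (λ v → k * g v) M ≡ k * conv f g M
conv-*ʳ zero f k g = x*[y*z]≡y*[x*z] (f 0) k (g 0)
conv-*ʳ (suc M) f k g =
  trans (cong₂ _+_ (x*[y*z]≡y*[x*z] (f (suc M)) k (g 0)) (conv-*ʳ M f k (λ v → g (suc v))))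
    (sym (ℕₚ.*-distribˡ-+ k _ _))

conv-∑ʳ : ∀ M f L (h : ℕ → ℕ → ℕ) → conv f (λ v → ∑ L (λ l → h l v)) M ≡ ∑ L (λ l → conv f (h l) M)
conv-∑ʳ M f zero h = conv-zeroʳ M f
conv-∑ʳ M f (suc L) h = trans (conv-+ʳ M f (h 0) (λ v → ∑ L (λ l → h (suc l) v)))
  (cong (_+_ (conv f (h 0) M)) (conv-∑ʳ M f L (λ l → h (suc l))))

-- f ⟨ n ∸ l ⟩ is f (n ∸ l) when l ≤ n, and 0 (not f 0) when l > n.
_⟨_∸_⟩ : (ℕ → ℕ) → ℕ → ℕ → ℕ
f ⟨ n ∸ zero ⟩ = f n
f ⟨ zero ∸ suc l ⟩ = 0
f ⟨ suc n ∸ suc l ⟩ = f ⟨ n ∸ l ⟩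

conv≡∑ : ∀ n L f g → n ℕ.< L → conv f g n ≡ ∑ L (λ l → f ⟨ n ∸ l ⟩ * g l)
conv≡∑ zero (suc L) f g _ = sym (trans (cong (_+_ (f 0 * g 0)) (∑-zero L)) (ℕₚ.+-identityʳ _))
conv≡∑ (suc n) (suc L) f g (s≤s n<L) = cong (_+_ (f (suc n) * g 0)) (conv≡∑ n L f (λ v → g (suc v)) n<L)

δ₀ : ℕ → ℕ
δ₀ zero = 1
δ₀ (suc _) = 0

conv-δ₀ʳ : ∀ M f → conv f δ₀ M ≡ f M
conv-δ₀ʳ zero f = ℕₚ.*-identityʳ (f 0)
conv-δ₀ʳ (suc M) f = trans (cong₂ _+_ (ℕₚ.*-identityʳ (f (suc M))) (conv-zeroʳ M f)) (ℕₚ.+-identityʳ _)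

partialSums : (ℕ → ℕ) → ℕ → ℕ
partialSums g zero = g 0
partialSums g (suc x) = partialSums g x + g (suc x)

partialSums-cong : ∀ M {g g′} → (∀ x → g x ≡ g′ x) → partialSums g M ≡ partialSums g′ M
partialSums-cong zero h = h 0
partialSums-cong (suc M) h = cong₂ _+_ (partialSums-cong M h) (h (suc M))

partialSums-suc : ∀ M g → partialSums g (suc M) ≡ g 0 + partialSums (λ v → g (suc v)) M
partialSums-suc zero g = refl
partialSums-suc (suc M) g = trans (cong (_+ g (suc (suc M))) (partialSums-suc M g)) (ℕₚ.+-assoc (g 0) _ _)

conv-partialSumsʳ : ∀ M f g → conv f (partialSums g) M ≡ partialSums (conv f g) M
conv-partialSumsʳ zero f g = refl
conv-partialSumsʳ (suc M) f g = begin
  f (suc M) * g 0 + conv f (λ v → partialSums g (suc v)) M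
    ≡⟨ cong (_+_ (f (suc M) * g 0)) (conv-+ʳ M f (partialSums g) (λ v → g (suc v))) ⟩
  f (suc M) * g 0 + (conv f (partialSums g) M + conv f (λ v → g (suc v)) M)
    ≡⟨ cong (λ z → f (suc M) * g 0 + (z + conv f (λ v → g (suc v)) M)) (conv-partialSumsʳ M f g) ⟩
  f (suc M) * g 0 + (partialSums (conv f g) M + conv f (λ v → g (suc v)) M)
    ≡⟨ x+[y+z]≡y+[x+z] (f (suc M) * g 0) (partialSums (conv f g) M) _ ⟩
  partialSums (conv f g) M + (f (suc M) * g 0 + conv f (λ v → g (suc v)) M) ∎
  where open ≡-Reasoning

conv-1ˡ : ∀ M g → conv (λ _ → 1) g M ≡ partialSums g M
conv-1ˡ zero g = ℕₚ.+-identityʳ (g 0)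
conv-1ˡ (suc M) g = trans (cong₂ _+_ (ℕₚ.+-identityʳ (g 0)) (conv-1ˡ M (λ v → g (suc v)))) (sym (partialSums-suc M g))

-- compositions c w counts c-tuples of naturals with sum w, i.e. C(w + c - 1, c - 1) for c ≥ 1.
compositions : ℕ → ℕ → ℕ
compositions zero = δ₀
compositions (suc c) = partialSums (compositions c)

conv-compositions : ∀ a b M → conv (compositions a) (compositions b) M ≡ compositions (a + b) M
conv-compositions a zero M rewrite ℕₚ.+-identityʳ a = conv-δ₀ʳ M (compositions a)
conv-compositions a (suc b) M rewrite ℕₚ.+-suc a b =
  trans (conv-partialSumsʳ M (compositions a) (compositions b)) (partialSums-cong M (conv-compositions a b))

compositions-0 : ∀ c → compositions c 0 ≡ 1
compositions-0 zero = refl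
compositions-0 (suc c) = compositions-0 c

compositions-1 : ∀ x → compositions 1 x ≡ 1
compositions-1 zero = refl
compositions-1 (suc x) = cong (_+ 0) (compositions-1 x)

compositions-suc-comm : ∀ j x → compositions (suc j) x ≡ compositions (suc x) j
compositions-suc-comm zero x = trans (compositions-1 x) (sym (compositions-0 (suc x)))
compositions-suc-comm (suc j) zero = trans (compositions-0 (suc (suc j))) (sym (compositions-1 (suc j)))
compositions-suc-comm (suc j) (suc x) = trans
  (cong₂ _+_ (compositions-suc-comm (suc j) x) (compositions-suc-comm j (suc x)))
  (ℕₚ.+-comm (compositions (suc x) (suc j)) (compositions (suc (suc x)) j))

mutual
  compositions-absorbˡ : ∀ j x → suc j * compositions (suc (suc j)) x ≡ (x + suc j) * compositions (suc j) x
  compositions-absorbˡ j zero rewrite compositions-0 (suc (suc j)) = refl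
  compositions-absorbˡ j (suc x) = begin
    suc j * (E (suc j) x + E j (suc x))          ≡⟨ ℕₚ.*-distribˡ-+ (suc j) (E (suc j) x) (E j (suc x)) ⟩
    suc j * E (suc j) x + suc j * E j (suc x)
      ≡⟨ cong (_+ suc j * E j (suc x)) (trans (compositions-absorbˡ j x) (sym (compositions-absorbʳ j x))) ⟩
    suc x * E j (suc x) + suc j * E j (suc x)   ≡⟨ sym (ℕₚ.*-distribʳ-+ (E j (suc x)) (suc x) (suc j)) ⟩
    (suc x + suc j) * E j (suc x) ∎
    where
    open ≡-Reasoning
    E : ℕ → ℕ → ℕ
    E j = compositions (suc j)

  compositions-absorbʳ : ∀ j x → suc x * compositions (suc j) (suc x) ≡ (x + suc j) * compositions (suc j) x
  compositions-absorbʳ zero x rewrite compositions-1 (suc x) | compositions-1 x | ℕₚ.+-comm x 1 = refl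
  compositions-absorbʳ (suc j) x = begin
    suc x * (E (suc j) x + E j (suc x))          ≡⟨ ℕₚ.*-distribˡ-+ (suc x) (E (suc j) x) (E j (suc x)) ⟩
    suc x * E (suc j) x + suc x * E j (suc x)
      ≡⟨ cong (_+_ (suc x * E (suc j) x)) (trans (compositions-absorbʳ j x) (sym (compositions-absorbˡ j x))) ⟩
    suc x * E (suc j) x + suc j * E (suc j) x   ≡⟨ sym (ℕₚ.*-distribʳ-+ (E (suc j) x) (suc x) (suc j)) ⟩
    (suc x + suc j) * E (suc j) x               ≡⟨ cong (_* E (suc j) x) (sym (ℕₚ.+-suc x (suc j))) ⟩
    (x + suc (suc j)) * E (suc j) x ∎
    where
    open ≡-Reasoning
    E : ℕ → ℕ → ℕ
    E j = compositions (suc j)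

compositions-recurrence : ∀ s r → suc r * compositions s (suc r) ≡ (s + r) * compositions s r
compositions-recurrence zero zero = refl
compositions-recurrence zero (suc r) = trans (ℕₚ.*-zeroʳ (suc (suc r))) (sym (ℕₚ.*-zeroʳ (suc r)))
compositions-recurrence (suc j) r =
  trans (compositions-absorbʳ j r) (cong (_* compositions (suc j) r) (trans (ℕₚ.+-suc r j) (cong suc (ℕₚ.+-comm r j))))

compositions-suc-+ : ∀ m v s L → m ℕ.< L →
  compositions (suc m) (v + s) ≡ ∑ L (λ l → compositions s ⟨ m ∸ l ⟩ * compositions (suc l) v)
compositions-suc-+ m v s L m<L = begin
  compositions (suc m) (v + s)                   ≡⟨ compositions-suc-comm m (v + s) ⟩
  compositions (suc (v + s)) m                   ≡⟨ cong (λ z → compositions z m) (sym (trans (ℕₚ.+-suc s v) (cong suc (ℕₚ.+-comm s v)))) ⟩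
  compositions (s + suc v) m                     ≡⟨ sym (conv-compositions s (suc v) m) ⟩
  conv (compositions s) (compositions (suc v)) m ≡⟨ conv-cong m (λ _ → refl) (λ l → compositions-suc-comm l v) ⟨
  conv (compositions s) (λ l → compositions (suc l) v) m
    ≡⟨ conv≡∑ m L (compositions s) (λ l → compositions (suc l) v) m<L ⟩
  ∑ L (λ l → compositions s ⟨ m ∸ l ⟩ * compositions (suc l) v) ∎
  where open ≡-Reasoning

conv-compositions-∑ : ∀ c L (γ : ℕ → ℕ) M →
  conv (compositions c) (λ v → ∑ L (λ l → γ l * compositions (suc l) v)) M ≡ ∑ L (λ l → γ l * compositions (suc (c + l)) M)
conv-compositions-∑ c L γ M = begin
  conv (compositions c) (λ v → ∑ L (λ l → γ l * compositions (suc l) v)) M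
    ≡⟨ conv-∑ʳ M (compositions c) L (λ l v → γ l * compositions (suc l) v) ⟩
  ∑ L (λ l → conv (compositions c) (λ v → γ l * compositions (suc l) v) M)
    ≡⟨ ∑-cong L (λ l _ → conv-*ʳ M (compositions c) (γ l) (compositions (suc l))) ⟩
  ∑ L (λ l → γ l * conv (compositions c) (compositions (suc l)) M)
    ≡⟨ ∑-cong L (λ l _ → cong (γ l *_) (trans (conv-compositions c (suc l) M) (cong (λ z → compositions z M) (ℕₚ.+-suc c l)))) ⟩
  ∑ L (λ l → γ l * compositions (suc (c + l)) M) ∎
  where open ≡-Reasoning

-- The flow count and its expansion

-- The entry (a , c) of a list describes a vertex with netflow a and c edges to the sink;
-- flowCount vs u counts integer flows when u extra units enter the first vertex along the path.
flowCount : List (ℕ × ℕ) → ℕ → ℕ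
flowCount [] u = 1
flowCount ((a , c) ∷ vs) u = conv (compositions c) (flowCount vs) (u + a)

scaleNetflows : ℕ → List (ℕ × ℕ) → List (ℕ × ℕ)
scaleNetflows t = map (Product.map₁ (t *_))

degree : List (ℕ × ℕ) → ℕ
degree [] = 0
degree ((a , c) ∷ vs) = c + degree vs

weight : List (ℕ × ℕ) → ℕ → ℕ → ℕ
weight [] l t = 1
weight ((a , c) ∷ vs) l t = ∑ (suc (degree vs)) (λ j → weight vs j t * compositions (t * a) ⟨ c + j ∸ l ⟩)

flowCount-expansion : ∀ a₀ c₀ vs t u → flowCount (scaleNetflows t ((a₀ , c₀) ∷ vs)) u
  ≡ ∑ (suc (degree vs)) (λ l → weight vs l t * compositions (suc (c₀ + l)) (u + t * a₀))
flowCount-expansion a₀ c₀ [] t u = begin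
  conv (compositions c₀) (λ _ → 1) M               ≡⟨ conv-cong M (λ _ → refl) (λ x → sym (compositions-1 x)) ⟩
  conv (compositions c₀) (compositions 1) M        ≡⟨ conv-compositions c₀ 1 M ⟩
  compositions (c₀ + 1) M                          ≡⟨ cong (λ z → compositions z M) (ℕₚ.+-suc c₀ 0) ⟩
  compositions (suc (c₀ + 0)) M                    ≡⟨ sym (trans (ℕₚ.+-identityʳ _) (ℕₚ.*-identityˡ _)) ⟩
  1 * compositions (suc (c₀ + 0)) M + 0 ∎
  where
  open ≡-Reasoning
  M = u + t * a₀
flowCount-expansion a₀ c₀ ((a₁ , c₁) ∷ vs) t u = begin
  conv (compositions c₀) (flowCount (scaleNetflows t ((a₁ , c₁) ∷ vs))) M
    ≡⟨ conv-cong M (λ _ → refl) expand-rest ⟩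
  conv (compositions c₀) (λ v → ∑ L (λ l → weight ((a₁ , c₁) ∷ vs) l t * compositions (suc l) v)) M
    ≡⟨ conv-compositions-∑ c₀ L (λ l → weight ((a₁ , c₁) ∷ vs) l t) M ⟩
  ∑ L (λ l → weight ((a₁ , c₁) ∷ vs) l t * compositions (suc (c₀ + l)) M) ∎
  where
  open ≡-Reasoning
  M = u + t * a₀
  D = degree vs
  L = suc (c₁ + D)
  expand-rest : ∀ v → flowCount (scaleNetflows t ((a₁ , c₁) ∷ vs)) v ≡ ∑ L (λ l → weight ((a₁ , c₁) ∷ vs) l t * compositions (suc l) v)
  expand-rest v = begin
    flowCount (scaleNetflows t ((a₁ , c₁) ∷ vs)) v
      ≡⟨ flowCount-expansion a₁ c₁ vs t v ⟩
    ∑ (suc D) (λ j → weight vs j t * compositions (suc (c₁ + j)) (v + t * a₁))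
      ≡⟨ ∑-cong (suc D) (λ j j≤D → cong (weight vs j t *_)
           (compositions-suc-+ (c₁ + j) v (t * a₁) L (s≤s (ℕₚ.+-monoʳ-≤ c₁ (ℕₚ.≤-pred j≤D))))) ⟩
    ∑ (suc D) (λ j → weight vs j t * ∑ L (λ l → compositions (t * a₁) ⟨ c₁ + j ∸ l ⟩ * compositions (suc l) v))
      ≡⟨ ∑-*-∑ (suc D) L (λ j → weight vs j t) (λ j l → compositions (t * a₁) ⟨ c₁ + j ∸ l ⟩) (λ l → compositions (suc l) v) ⟩
    ∑ L (λ l → weight ((a₁ , c₁) ∷ vs) l t * compositions (suc l) v) ∎

-- Polynomials with rational coefficients

-- ℕtoℚ m normalises m / 1 through a gcd, which blocks computation; fromℕ m is the same number
-- written directly in lowest terms.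
fromℕ : ℕ → ℚ
fromℕ m = mkℚ (+ m) 0 (Coprime.sym (Coprime.1-coprimeTo m))

ℕtoℚ≡fromℕ : ∀ m → ℕtoℚ m ≡ fromℕ m
ℕtoℚ≡fromℕ m = ℚₚ.↥p/↧p≡p (fromℕ m)

ℕtoℚ-+ : ∀ m n → ℕtoℚ (m + n) ≡ ℕtoℚ m ℚ.+ ℕtoℚ n
ℕtoℚ-+ m n = sym (trans (cong₂ ℚ._+_ (ℕtoℚ≡fromℕ m) (ℕtoℚ≡fromℕ n))
  (ℚₚ./-cong {p₁ = + m ℤ.* + 1 ℤ.+ + n ℤ.* + 1} {q₁ = 1} {p₂ = + (m + n)} {q₂ = 1}
     (cong₂ ℤ._+_ (ℤₚ.*-identityʳ (+ m)) (ℤₚ.*-identityʳ (+ n))) refl))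

ℕtoℚ-* : ∀ m n → ℕtoℚ (m * n) ≡ ℕtoℚ m ℚ.* ℕtoℚ n
ℕtoℚ-* m n = sym (trans (cong₂ ℚ._*_ (ℕtoℚ≡fromℕ m) (ℕtoℚ≡fromℕ n))
  (ℚₚ./-cong {p₁ = + m ℤ.* + n} {q₁ = 1} {p₂ = + (m * n)} {q₂ = 1} (sym (ℤₚ.pos-* m n)) refl))

ℕtoℚ-nonNeg : ∀ m → ℚ.NonNegative (ℕtoℚ m)
ℕtoℚ-nonNeg m = subst ℚ.NonNegative (sym (ℕtoℚ≡fromℕ m)) _

ℕtoℚ-suc-pos : ∀ m → ℚ.Positive (ℕtoℚ (suc m))
ℕtoℚ-suc-pos m = subst ℚ.Positive (sym (ℕtoℚ≡fromℕ (suc m))) _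

1/[1+_] : ℕ → ℚ
1/[1+ r ] = ℚ.1/ fromℕ (suc r)

1/[1+r]-pos : ∀ r → ℚ.Positive 1/[1+ r ]
1/[1+r]-pos r = ℚₚ.1/pos⇒pos (fromℕ (suc r))

1/[1+r]*[1+r]≡1 : ∀ r → 1/[1+ r ] ℚ.* ℕtoℚ (suc r) ≡ 1ℚ
1/[1+r]*[1+r]≡1 r = trans (cong (1/[1+ r ] ℚ.*_) (ℕtoℚ≡fromℕ (suc r))) (ℚₚ.*-inverseˡ (fromℕ (suc r)))

infixl 6 _+ᴾ_
infixr 7 _·ᴾ_ _*ᴾ_

_+ᴾ_ : List ℚ → List ℚ → List ℚ
[] +ᴾ q = q
(x ∷ p) +ᴾ [] = x ∷ p
(x ∷ p) +ᴾ (y ∷ q) = x ℚ.+ y ∷ p +ᴾ q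

_·ᴾ_ : ℚ → List ℚ → List ℚ
x ·ᴾ [] = []
x ·ᴾ (y ∷ q) = x ℚ.* y ∷ x ·ᴾ q

X*ᴾ_ : List ℚ → List ℚ
X*ᴾ [] = []
X*ᴾ (y ∷ q) = 0ℚ ∷ y ∷ q

_*ᴾ_ : List ℚ → List ℚ → List ℚ
[] *ᴾ q = []
(x ∷ p) *ᴾ q = x ·ᴾ q +ᴾ X*ᴾ (p *ᴾ q)

∑ᴾ : ℕ → (ℕ → List ℚ) → List ℚ
∑ᴾ zero P = []
∑ᴾ (suc N) P = P 0 +ᴾ ∑ᴾ N (λ j → P (suc j))

module _ where
  open ℚ-Solver.+-*-Solver
  open ≡-Reasoning

  evalPoly-+ᴾ : ∀ p q x → evalPoly (p +ᴾ q) x ≡ evalPoly p x ℚ.+ evalPoly q x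
  evalPoly-+ᴾ [] q x = sym (ℚₚ.+-identityˡ _)
  evalPoly-+ᴾ (a ∷ p) [] x = sym (ℚₚ.+-identityʳ _)
  evalPoly-+ᴾ (a ∷ p) (b ∷ q) x = begin
    (a ℚ.+ b) ℚ.+ x ℚ.* evalPoly (p +ᴾ q) x        ≡⟨ cong (λ z → (a ℚ.+ b) ℚ.+ x ℚ.* z) (evalPoly-+ᴾ p q x) ⟩
    (a ℚ.+ b) ℚ.+ x ℚ.* (evalPoly p x ℚ.+ evalPoly q x)
      ≡⟨ solve 5 (λ a b x u v → (a :+ b) :+ x :* (u :+ v) := (a :+ x :* u) :+ (b :+ x :* v)) refl a b x (evalPoly p x) (evalPoly q x) ⟩
    (a ℚ.+ x ℚ.* evalPoly p x) ℚ.+ (b ℚ.+ x ℚ.* evalPoly q x) ∎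

  evalPoly-·ᴾ : ∀ a q x → evalPoly (a ·ᴾ q) x ≡ a ℚ.* evalPoly q x
  evalPoly-·ᴾ a [] x = sym (ℚₚ.*-zeroʳ a)
  evalPoly-·ᴾ a (b ∷ q) x = trans (cong (λ z → a ℚ.* b ℚ.+ x ℚ.* z) (evalPoly-·ᴾ a q x))
    (solve 4 (λ a b x u → a :* b :+ x :* (a :* u) := a :* (b :+ x :* u)) refl a b x (evalPoly q x))

  evalPoly-X*ᴾ : ∀ q x → evalPoly (X*ᴾ q) x ≡ x ℚ.* evalPoly q x
  evalPoly-X*ᴾ [] x = sym (ℚₚ.*-zeroʳ x)
  evalPoly-X*ᴾ (b ∷ q) x = ℚₚ.+-identityˡ (x ℚ.* evalPoly (b ∷ q) x)

  evalPoly-*ᴾ : ∀ p q x → evalPoly (p *ᴾ q) x ≡ evalPoly p x ℚ.* evalPoly q x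
  evalPoly-*ᴾ [] q x = sym (ℚₚ.*-zeroˡ (evalPoly q x))
  evalPoly-*ᴾ (a ∷ p) q x = begin
    evalPoly (a ·ᴾ q +ᴾ X*ᴾ (p *ᴾ q)) x                   ≡⟨ evalPoly-+ᴾ (a ·ᴾ q) _ x ⟩
    evalPoly (a ·ᴾ q) x ℚ.+ evalPoly (X*ᴾ (p *ᴾ q)) x
      ≡⟨ cong₂ ℚ._+_ (evalPoly-·ᴾ a q x) (trans (evalPoly-X*ᴾ (p *ᴾ q) x) (cong (x ℚ.*_) (evalPoly-*ᴾ p q x))) ⟩
    a ℚ.* evalPoly q x ℚ.+ x ℚ.* (evalPoly p x ℚ.* evalPoly q x)
      ≡⟨ solve 4 (λ a v x u → a :* v :+ x :* (u :* v) := (a :+ x :* u) :* v) refl a (evalPoly q x) x (evalPoly p x) ⟩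
    (a ℚ.+ x ℚ.* evalPoly p x) ℚ.* evalPoly q x ∎

NonNegDeg≤ : ℕ → List ℚ → Set
NonNegDeg≤ d p = All ℚ.NonNegative p × length p ≤ suc d

PosDeg : ℕ → List ℚ → Set
PosDeg d p = All ℚ.Positive p × length p ≡ suc d

+ᴾ-nonNeg : ∀ {p q} → All ℚ.NonNegative p → All ℚ.NonNegative q → All ℚ.NonNegative (p +ᴾ q)
+ᴾ-nonNeg {[]} hp hq = hq
+ᴾ-nonNeg {x ∷ p} {[]} hp hq = hp
+ᴾ-nonNeg {x ∷ p} {y ∷ q} (hx ∷ hp) (hy ∷ hq) = ℚₚ.nonNeg+nonNeg⇒nonNeg x {{hx}} y {{hy}} ∷ +ᴾ-nonNeg hp hq

+ᴾ-pos : ∀ {p q} → All ℚ.Positive p → All ℚ.Positive q → All ℚ.Positive (p +ᴾ q)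
+ᴾ-pos {[]} hp hq = hq
+ᴾ-pos {x ∷ p} {[]} hp hq = hp
+ᴾ-pos {x ∷ p} {y ∷ q} (hx ∷ hp) (hy ∷ hq) = ℚₚ.pos+pos⇒pos x {{hx}} y {{hy}} ∷ +ᴾ-pos hp hq

·ᴾ-nonNeg : ∀ {x q} → ℚ.NonNegative x → All ℚ.NonNegative q → All ℚ.NonNegative (x ·ᴾ q)
·ᴾ-nonNeg hx [] = []
·ᴾ-nonNeg {x} hx (hy ∷ hq) = ℚₚ.nonNeg*nonNeg⇒nonNeg x {{hx}} _ {{hy}} ∷ ·ᴾ-nonNeg hx hq

·ᴾ-pos : ∀ {x q} → ℚ.Positive x → All ℚ.Positive q → All ℚ.Positive (x ·ᴾ q)
·ᴾ-pos hx [] = []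
·ᴾ-pos {x} hx (hy ∷ hq) = ℚₚ.pos*pos⇒pos x {{hx}} _ {{hy}} ∷ ·ᴾ-pos hx hq

*ᴾ-nonNeg : ∀ {p q} → All ℚ.NonNegative p → All ℚ.NonNegative q → All ℚ.NonNegative (p *ᴾ q)
*ᴾ-nonNeg [] hq = []
*ᴾ-nonNeg (hx ∷ hp) hq = +ᴾ-nonNeg (·ᴾ-nonNeg hx hq) (X*ᴾ-nonNeg (*ᴾ-nonNeg hp hq))
  where
  X*ᴾ-nonNeg : ∀ {q} → All ℚ.NonNegative q → All ℚ.NonNegative (X*ᴾ q)
  X*ᴾ-nonNeg [] = []
  X*ᴾ-nonNeg (hy ∷ hq) = _ ∷ hy ∷ hq

length-+ᴾ : ∀ p q → length (p +ᴾ q) ≡ length p ⊔ length q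
length-+ᴾ [] q = refl
length-+ᴾ (x ∷ p) [] = refl
length-+ᴾ (x ∷ p) (y ∷ q) = cong suc (length-+ᴾ p q)

length-·ᴾ : ∀ x q → length (x ·ᴾ q) ≡ length q
length-·ᴾ x [] = refl
length-·ᴾ x (y ∷ q) = cong suc (length-·ᴾ x q)

+ᴾ-preserves-length≤ : ∀ {m} p q → length p ≤ m → length q ≤ m → length (p +ᴾ q) ≤ m
+ᴾ-preserves-length≤ p q hp hq = subst (_≤ _) (sym (length-+ᴾ p q)) (ℕₚ.⊔-lub hp hq)

*ᴾ-deg≤ : ∀ d₁ d₂ p q → length p ≤ suc d₁ → length q ≤ suc d₂ → length (p *ᴾ q) ≤ suc (d₁ + d₂)
*ᴾ-deg≤ d₁ d₂ [] q hp hq = z≤n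
*ᴾ-deg≤ d₁ d₂ (x ∷ []) q hp hq =
  +ᴾ-preserves-length≤ (x ·ᴾ q) [] (subst (_≤ _) (sym (length-·ᴾ x q)) (ℕₚ.≤-trans hq (s≤s (ℕₚ.m≤n+m d₂ d₁)))) z≤n
*ᴾ-deg≤ (suc d₁) d₂ (x ∷ y ∷ p) q (s≤s hp) hq =
  +ᴾ-preserves-length≤ (x ·ᴾ q) (X*ᴾ ((y ∷ p) *ᴾ q))
    (subst (_≤ _) (sym (length-·ᴾ x q)) (ℕₚ.≤-trans hq (s≤s (ℕₚ.≤-trans (ℕₚ.m≤n+m d₂ d₁) (ℕₚ.n≤1+n _)))))
    (X*ᴾ-length≤ ((y ∷ p) *ᴾ q) (*ᴾ-deg≤ d₁ d₂ (y ∷ p) q hp hq))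
  where
  X*ᴾ-length≤ : ∀ {m} r → length r ≤ m → length (X*ᴾ r) ≤ suc m
  X*ᴾ-length≤ [] h = z≤n
  X*ᴾ-length≤ (z ∷ r) h = s≤s h

[]-nonNegDeg≤ : ∀ {d} → NonNegDeg≤ d []
[]-nonNegDeg≤ = [] , z≤n

nonNegDeg≤-mono : ∀ {d d′ p} → d ≤ d′ → NonNegDeg≤ d p → NonNegDeg≤ d′ p
nonNegDeg≤-mono d≤d′ (h , l) = h , ℕₚ.≤-trans l (s≤s d≤d′)

+ᴾ-nonNegDeg≤ : ∀ {d p q} → NonNegDeg≤ d p → NonNegDeg≤ d q → NonNegDeg≤ d (p +ᴾ q)
+ᴾ-nonNegDeg≤ {p = p} {q} (hp , lp) (hq , lq) = +ᴾ-nonNeg hp hq , +ᴾ-preserves-length≤ p q lp lq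

*ᴾ-nonNegDeg≤ : ∀ {d₁ d₂ p q} → NonNegDeg≤ d₁ p → NonNegDeg≤ d₂ q → NonNegDeg≤ (d₁ + d₂) (p *ᴾ q)
*ᴾ-nonNegDeg≤ {d₁} {d₂} {p} {q} (hp , lp) (hq , lq) = *ᴾ-nonNeg hp hq , *ᴾ-deg≤ d₁ d₂ p q lp lq

posDeg⇒nonNegDeg≤ : ∀ {d p} → PosDeg d p → NonNegDeg≤ d p
posDeg⇒nonNegDeg≤ (hp , lp) = All.map (λ {x} h → ℚₚ.pos⇒nonNeg x {{h}}) hp , ℕₚ.≤-reflexive lp

+ᴾ-pos-length : ∀ p q → All ℚ.Positive p → All ℚ.NonNegative q → length q ≤ length p →
  All ℚ.Positive (p +ᴾ q) × length (p +ᴾ q) ≡ length p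
+ᴾ-pos-length [] [] hp hq hl = [] , refl
+ᴾ-pos-length (x ∷ p) [] hp hq hl = hp , refl
+ᴾ-pos-length (x ∷ p) (y ∷ q) (hx ∷ hp) (hy ∷ hq) (s≤s hl) =
  let (hpq , lpq) = +ᴾ-pos-length p q hp hq hl in ℚₚ.pos+nonNeg⇒pos x {{hx}} y {{hy}} ∷ hpq , cong suc lpq

+ᴾ-comm : ∀ p q → p +ᴾ q ≡ q +ᴾ p
+ᴾ-comm [] [] = refl
+ᴾ-comm [] (x ∷ q) = refl
+ᴾ-comm (x ∷ p) [] = refl
+ᴾ-comm (x ∷ p) (y ∷ q) = cong₂ _∷_ (ℚₚ.+-comm x y) (+ᴾ-comm p q)

+ᴾ-posDegˡ : ∀ {d} p q → PosDeg d p → NonNegDeg≤ d q → PosDeg d (p +ᴾ q)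
+ᴾ-posDegˡ p q (hp , lp) (hq , lq) =
  let (hpq , lpq) = +ᴾ-pos-length p q hp hq (subst (length q ≤_) (sym lp) lq) in hpq , trans lpq lp

+ᴾ-posDegʳ : ∀ {d} p q → NonNegDeg≤ d p → PosDeg d q → PosDeg d (p +ᴾ q)
+ᴾ-posDegʳ p q hp hq = subst (PosDeg _) (+ᴾ-comm q p) (+ᴾ-posDegˡ q p hq hp)

+ᴾ-identityʳ : ∀ p → p +ᴾ [] ≡ p
+ᴾ-identityʳ [] = refl
+ᴾ-identityʳ (x ∷ p) = refl

*ᴾ-zeroʳ : ∀ p → p *ᴾ [] ≡ []
*ᴾ-zeroʳ [] = refl
*ᴾ-zeroʳ (x ∷ p) rewrite *ᴾ-zeroʳ p = refl

const-*ᴾ-posDeg : ∀ {d c P} → PosDeg 0 c → PosDeg d P → PosDeg d (c *ᴾ P)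
const-*ᴾ-posDeg {c = x ∷ []} {P} (hx ∷ [] , _) (hP , lP) rewrite +ᴾ-identityʳ (x ·ᴾ P) =
  ·ᴾ-pos hx hP , trans (length-·ᴾ x P) lP

linear-*ᴾ-posDeg : ∀ {u v d P} → ℚ.Positive u → ℚ.Positive v → PosDeg d P → PosDeg (suc d) ((u ∷ v ∷ []) *ᴾ P)
linear-*ᴾ-posDeg {u} {v} {d} {y ∷ P} hu hv (hy ∷ hP , lP) rewrite +ᴾ-identityʳ (v ·ᴾ (y ∷ P)) =
  ℚₚ.pos+nonNeg⇒pos (u ℚ.* y) {{ℚₚ.pos*pos⇒pos u {{hu}} y {{hy}}}} 0ℚ ∷ +ᴾ-pos (·ᴾ-pos hu hP) (·ᴾ-pos hv (hy ∷ hP)) ,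
  cong suc (begin
    length (u ·ᴾ P +ᴾ v ·ᴾ (y ∷ P))            ≡⟨ length-+ᴾ (u ·ᴾ P) (v ·ᴾ (y ∷ P)) ⟩
    length (u ·ᴾ P) ⊔ length (v ·ᴾ (y ∷ P))    ≡⟨ cong₂ _⊔_ (length-·ᴾ u P) (length-·ᴾ v (y ∷ P)) ⟩
    length P ⊔ suc (length P)                  ≡⟨ ℕₚ.m≤n⇒m⊔n≡n (ℕₚ.n≤1+n (length P)) ⟩
    suc (length P)                             ≡⟨ lP ⟩
    suc d ∎)
  where open ≡-Reasoning

∑ᴾ-nonNegDeg≤ : ∀ {d} N P → (∀ j → j ℕ.< N → NonNegDeg≤ d (P j)) → NonNegDeg≤ d (∑ᴾ N P)
∑ᴾ-nonNegDeg≤ zero P h = []-nonNegDeg≤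
∑ᴾ-nonNegDeg≤ (suc N) P h = +ᴾ-nonNegDeg≤ (h 0 (s≤s z≤n)) (∑ᴾ-nonNegDeg≤ N (λ j → P (suc j)) (λ j j<N → h (suc j) (s≤s j<N)))

∑ᴾ-posDeg : ∀ {d} N P j₀ → j₀ ℕ.< N → (∀ j → j ℕ.< N → NonNegDeg≤ d (P j)) → PosDeg d (P j₀) → PosDeg d (∑ᴾ N P)
∑ᴾ-posDeg (suc N) P zero _ h hP =
  +ᴾ-posDegˡ (P 0) _ hP (∑ᴾ-nonNegDeg≤ N (λ j → P (suc j)) (λ j j<N → h (suc j) (s≤s j<N)))
∑ᴾ-posDeg (suc N) P (suc j₀) (s≤s j₀<N) h hP =
  +ᴾ-posDegʳ (P 0) _ (h 0 (s≤s z≤n)) (∑ᴾ-posDeg N (λ j → P (suc j)) j₀ j₀<N (λ j j<N → h (suc j) (s≤s j<N)) hP)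

-- Counting functions that are polynomials

infix 4 _≗ᴾ_

-- A record, not a function type, so that f and p can be inferred from a proof of f ≗ᴾ p.

record _≗ᴾ_ (f : ℕ → ℕ) (p : List ℚ) : Set where
  constructor mk≗ᴾ
  field at : ∀ t → ℕtoℚ (f t) ≡ evalPoly p (ℕtoℚ t)

open _≗ᴾ_

1≗ᴾ : (λ _ → 1) ≗ᴾ 1ℚ ∷ []
1≗ᴾ .at t = sym (trans (cong (1ℚ ℚ.+_) (ℚₚ.*-zeroʳ (ℕtoℚ t))) (ℚₚ.+-identityʳ 1ℚ))

≗ᴾ-* : ∀ {f g p q} → f ≗ᴾ p → g ≗ᴾ q → (λ t → f t * g t) ≗ᴾ p *ᴾ q
≗ᴾ-* {f} {g} {p} {q} f≗p g≗q .at t =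
  trans (ℕtoℚ-* (f t) (g t)) (trans (cong₂ ℚ._*_ (f≗p .at t) (g≗q .at t)) (sym (evalPoly-*ᴾ p q (ℕtoℚ t))))

≗ᴾ-∑ : ∀ N {f : ℕ → ℕ → ℕ} {P} → (∀ j → j ℕ.< N → f j ≗ᴾ P j) → (λ t → ∑ N (λ j → f j t)) ≗ᴾ ∑ᴾ N P
≗ᴾ-∑ zero h .at t = refl
≗ᴾ-∑ (suc N) {f} {P} h .at t = begin
  ℕtoℚ (f 0 t + ∑ N (λ j → f (suc j) t))                      ≡⟨ ℕtoℚ-+ (f 0 t) _ ⟩
  ℕtoℚ (f 0 t) ℚ.+ ℕtoℚ (∑ N (λ j → f (suc j) t))
    ≡⟨ cong₂ ℚ._+_ (h 0 (s≤s z≤n) .at t) (≗ᴾ-∑ N (λ j j<N → h (suc j) (s≤s j<N)) .at t) ⟩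
  evalPoly (P 0) (ℕtoℚ t) ℚ.+ evalPoly (∑ᴾ N (λ j → P (suc j))) (ℕtoℚ t) ≡⟨ evalPoly-+ᴾ (P 0) _ (ℕtoℚ t) ⟨
  evalPoly (∑ᴾ (suc N) P) (ℕtoℚ t) ∎
  where open ≡-Reasoning

-- compositions (b + t a) r = ∏_{k < r} (b + k + a t) / (k + 1)
compositionsᴾ : ℕ → ℕ → ℕ → List ℚ
compositionsᴾ a b zero = 1ℚ ∷ []
compositionsᴾ a b (suc r) = (ℕtoℚ (b + r) ℚ.* 1/[1+ r ] ∷ ℕtoℚ a ℚ.* 1/[1+ r ] ∷ []) *ᴾ compositionsᴾ a b r

compositions≗ᴾ : ∀ a b r → (λ t → compositions (b + t * a) r) ≗ᴾ compositionsᴾ a b r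
compositions≗ᴾ a b zero .at t = trans (cong ℕtoℚ (compositions-0 (b + t * a))) (1≗ᴾ .at t)
compositions≗ᴾ a b (suc r) .at t = begin
  X                                          ≡⟨ ℚₚ.*-identityˡ X ⟨
  1ℚ ℚ.* X                                   ≡⟨ cong (ℚ._* X) (1/[1+r]*[1+r]≡1 r) ⟨
  (i ℚ.* ℕtoℚ (suc r)) ℚ.* X                 ≡⟨ ℚₚ.*-assoc i (ℕtoℚ (suc r)) X ⟩
  i ℚ.* (ℕtoℚ (suc r) ℚ.* X)                 ≡⟨ cong (i ℚ.*_) recurrence ⟩
  i ℚ.* ((B ℚ.+ T ℚ.* A ℚ.+ R) ℚ.* Y)
    ≡⟨ solve 6 (λ i B T A R Y → i :* ((B :+ T :* A :+ R) :* Y) := ((B :+ R) :* i :+ T :* (A :* i :+ T :* con 0ℚ)) :* Y) refl i B T A R Y ⟩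
  ((B ℚ.+ R) ℚ.* i ℚ.+ T ℚ.* (A ℚ.* i ℚ.+ T ℚ.* 0ℚ)) ℚ.* Y
    ≡⟨ cong₂ ℚ._*_ (cong (λ z → z ℚ.* i ℚ.+ T ℚ.* (A ℚ.* i ℚ.+ T ℚ.* 0ℚ)) (sym (ℕtoℚ-+ b r))) (compositions≗ᴾ a b r .at t) ⟩
  evalPoly (ℕtoℚ (b + r) ℚ.* i ∷ A ℚ.* i ∷ []) T ℚ.* evalPoly (compositionsᴾ a b r) T
    ≡⟨ evalPoly-*ᴾ (ℕtoℚ (b + r) ℚ.* i ∷ A ℚ.* i ∷ []) (compositionsᴾ a b r) T ⟨
  evalPoly (compositionsᴾ a b (suc r)) T ∎
  where
  open ≡-Reasoning
  open ℚ-Solver.+-*-Solver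
  s = b + t * a
  X = ℕtoℚ (compositions s (suc r))
  Y = ℕtoℚ (compositions s r)
  i = 1/[1+ r ]
  T = ℕtoℚ t
  A = ℕtoℚ a
  B = ℕtoℚ b
  R = ℕtoℚ r
  recurrence : ℕtoℚ (suc r) ℚ.* X ≡ (B ℚ.+ T ℚ.* A ℚ.+ R) ℚ.* Y
  recurrence = begin
    ℕtoℚ (suc r) ℚ.* X                    ≡⟨ ℕtoℚ-* (suc r) (compositions s (suc r)) ⟨
    ℕtoℚ (suc r * compositions s (suc r)) ≡⟨ cong ℕtoℚ (compositions-recurrence s r) ⟩
    ℕtoℚ ((s + r) * compositions s r)     ≡⟨ ℕtoℚ-* (s + r) (compositions s r) ⟩
    ℕtoℚ (s + r) ℚ.* Y
      ≡⟨ cong (ℚ._* Y) (trans (ℕtoℚ-+ s r) (cong (ℚ._+ R) (trans (ℕtoℚ-+ b (t * a)) (cong (B ℚ.+_) (ℕtoℚ-* t a))))) ⟩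
    (B ℚ.+ T ℚ.* A ℚ.+ R) ℚ.* Y ∎

compositionsᴾ-nonNegDeg≤ : ∀ a b r → NonNegDeg≤ r (compositionsᴾ a b r)
compositionsᴾ-nonNegDeg≤ a b zero = (_ ∷ []) , s≤s z≤n
compositionsᴾ-nonNegDeg≤ a b (suc r) = *ᴾ-nonNegDeg≤ {1} {r}
  ((coeff-nonNeg (b + r) ∷ coeff-nonNeg a ∷ []) , ℕₚ.≤-refl) (compositionsᴾ-nonNegDeg≤ a b r)
  where
  coeff-nonNeg : ∀ m → ℚ.NonNegative (ℕtoℚ m ℚ.* 1/[1+ r ])
  coeff-nonNeg m = ℚₚ.nonNeg*nonNeg⇒nonNeg (ℕtoℚ m) {{ℕtoℚ-nonNeg m}} _ {{ℚₚ.pos⇒nonNeg 1/[1+ r ] {{1/[1+r]-pos r}}}}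

compositionsᴾ-posDeg : ∀ a r → PosDeg r (compositionsᴾ (suc a) 1 r)
compositionsᴾ-posDeg a zero = (_ ∷ []) , refl
compositionsᴾ-posDeg a (suc r) =
  linear-*ᴾ-posDeg (coeff-pos r) (coeff-pos a) (compositionsᴾ-posDeg a r)
  where
  coeff-pos : ∀ m → ℚ.Positive (ℕtoℚ (suc m) ℚ.* 1/[1+ r ])
  coeff-pos m = ℚₚ.pos*pos⇒pos (ℕtoℚ (suc m)) {{ℕtoℚ-suc-pos m}} _ {{1/[1+r]-pos r}}

_⟨_∸_⟩ᴾ : (ℕ → List ℚ) → ℕ → ℕ → List ℚ
P ⟨ n ∸ zero ⟩ᴾ = P n
P ⟨ zero ∸ suc l ⟩ᴾ = []
P ⟨ suc n ∸ suc l ⟩ᴾ = P ⟨ n ∸ l ⟩ᴾ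

⟨∸⟩-≗ᴾ : ∀ {F : ℕ → ℕ → ℕ} {P} → (∀ r → (λ t → F t r) ≗ᴾ P r) → ∀ n l → (λ t → F t ⟨ n ∸ l ⟩) ≗ᴾ P ⟨ n ∸ l ⟩ᴾ
⟨∸⟩-≗ᴾ h n zero = h n
⟨∸⟩-≗ᴾ h zero (suc l) .at t = refl
⟨∸⟩-≗ᴾ h (suc n) (suc l) = ⟨∸⟩-≗ᴾ h n l

⟨∸⟩ᴾ-nonNegDeg≤ : ∀ {P} → (∀ r → NonNegDeg≤ r (P r)) → ∀ n l → NonNegDeg≤ (n ∸ l) (P ⟨ n ∸ l ⟩ᴾ)
⟨∸⟩ᴾ-nonNegDeg≤ h n zero = h n
⟨∸⟩ᴾ-nonNegDeg≤ h zero (suc l) = []-nonNegDeg≤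
⟨∸⟩ᴾ-nonNegDeg≤ h (suc n) (suc l) = ⟨∸⟩ᴾ-nonNegDeg≤ h n l

⟨∸⟩ᴾ-out-of-range : ∀ P n l → n ℕ.< l → P ⟨ n ∸ l ⟩ᴾ ≡ []
⟨∸⟩ᴾ-out-of-range P zero (suc l) _ = refl
⟨∸⟩ᴾ-out-of-range P (suc n) (suc l) (s≤s n<l) = ⟨∸⟩ᴾ-out-of-range P n l n<l

⟨n∸n⟩ᴾ : ∀ P n → P ⟨ n ∸ n ⟩ᴾ ≡ P 0
⟨n∸n⟩ᴾ P zero = refl
⟨n∸n⟩ᴾ P (suc n) = ⟨n∸n⟩ᴾ P n

weightᴾ : List (ℕ × ℕ) → ℕ → List ℚ
weightᴾ [] l = 1ℚ ∷ []
weightᴾ ((a , c) ∷ vs) l = ∑ᴾ (suc (degree vs)) (λ j → weightᴾ vs j *ᴾ compositionsᴾ a 0 ⟨ c + j ∸ l ⟩ᴾ)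

weight≗ᴾ : ∀ vs l → weight vs l ≗ᴾ weightᴾ vs l
weight≗ᴾ [] l = 1≗ᴾ
weight≗ᴾ ((a , c) ∷ vs) l = ≗ᴾ-∑ (suc (degree vs))
  (λ j _ → ≗ᴾ-* (weight≗ᴾ vs j) (⟨∸⟩-≗ᴾ (compositions≗ᴾ a 0) (c + j) l))

weightᴾ-term-nonNegDeg≤ : ∀ a c vs l j → j ≤ degree vs →
  NonNegDeg≤ ((c + degree vs) ∸ l) (weightᴾ vs j *ᴾ compositionsᴾ a 0 ⟨ c + j ∸ l ⟩ᴾ)
weightᴾ-nonNegDeg≤ : ∀ vs l → NonNegDeg≤ (degree vs ∸ l) (weightᴾ vs l)

weightᴾ-term-nonNegDeg≤ a c vs l j j≤D with l ℕₚ.≤? c + j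
... | yes l≤c+j = nonNegDeg≤-mono (ℕₚ.≤-reflexive degrees-add)
        (*ᴾ-nonNegDeg≤ (weightᴾ-nonNegDeg≤ vs j) (⟨∸⟩ᴾ-nonNegDeg≤ (compositionsᴾ-nonNegDeg≤ a 0) (c + j) l))
  where
  open ≡-Reasoning
  degrees-add : (degree vs ∸ j) + ((c + j) ∸ l) ≡ (c + degree vs) ∸ l
  degrees-add = begin
    (degree vs ∸ j) + ((c + j) ∸ l)  ≡⟨ ℕₚ.+-comm (degree vs ∸ j) _ ⟩
    ((c + j) ∸ l) + (degree vs ∸ j)  ≡⟨ ℕₚ.+-∸-comm (degree vs ∸ j) l≤c+j ⟨
    ((c + j) + (degree vs ∸ j)) ∸ l  ≡⟨ cong (_∸ l) (trans (ℕₚ.+-assoc c j _) (cong (_+_ c) (ℕₚ.m+[n∸m]≡n j≤D))) ⟩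
    (c + degree vs) ∸ l ∎
... | no l≰c+j rewrite ⟨∸⟩ᴾ-out-of-range (compositionsᴾ a 0) (c + j) l (ℕₚ.≰⇒> l≰c+j) | *ᴾ-zeroʳ (weightᴾ vs j) =
  []-nonNegDeg≤

weightᴾ-nonNegDeg≤ [] l rewrite ℕₚ.0∸n≡0 l = (_ ∷ []) , ℕₚ.≤-refl
weightᴾ-nonNegDeg≤ ((a , c) ∷ vs) l =
  ∑ᴾ-nonNegDeg≤ (suc (degree vs)) _ (λ j j≤D → weightᴾ-term-nonNegDeg≤ a c vs l j (ℕₚ.≤-pred j≤D))

weightᴾ-top : ∀ vs → PosDeg 0 (weightᴾ vs (degree vs))
weightᴾ-top [] = (_ ∷ []) , refl
weightᴾ-top ((a , c) ∷ vs) = ∑ᴾ-posDeg (suc D) _ D (ℕₚ.n<1+n D)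
  (λ j j≤D → subst (λ d → NonNegDeg≤ d (term j)) (ℕₚ.n∸n≡0 (c + D))
     (weightᴾ-term-nonNegDeg≤ a c vs (c + D) j (ℕₚ.≤-pred j≤D)))
  (subst (λ q → PosDeg 0 (weightᴾ vs D *ᴾ q)) (sym (⟨n∸n⟩ᴾ (compositionsᴾ a 0) (c + D)))
     (const-*ᴾ-posDeg (weightᴾ-top vs) ((_ ∷ []) , refl)))
  where
  D = degree vs
  term : ℕ → List ℚ
  term j = weightᴾ vs j *ᴾ compositionsᴾ a 0 ⟨ c + j ∸ (c + D) ⟩ᴾ

flowCountᴾ : ℕ → ℕ → List (ℕ × ℕ) → List ℚ
flowCountᴾ a c vs = ∑ᴾ (suc (degree vs)) (λ l → weightᴾ vs l *ᴾ compositionsᴾ (suc a) 1 (c + l))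

flowCount≗flowCountᴾ : ∀ a c vs → (λ t → flowCount (scaleNetflows t ((suc a , c) ∷ vs)) 0) ≗ᴾ flowCountᴾ a c vs
flowCount≗flowCountᴾ a c vs .at t = begin
  ℕtoℚ (flowCount (scaleNetflows t ((suc a , c) ∷ vs)) 0)
    ≡⟨ cong ℕtoℚ (flowCount-expansion (suc a) c vs t 0) ⟩
  ℕtoℚ (∑ (suc D) (λ l → weight vs l t * compositions (suc (c + l)) (t * suc a)))
    ≡⟨ cong ℕtoℚ (∑-cong (suc D) (λ l _ → cong (weight vs l t *_) (compositions-suc-comm (c + l) (t * suc a)))) ⟩
  ℕtoℚ (∑ (suc D) (λ l → weight vs l t * compositions (1 + t * suc a) (c + l)))
    ≡⟨ ≗ᴾ-∑ (suc D) (λ l _ → ≗ᴾ-* (weight≗ᴾ vs l) (compositions≗ᴾ (suc a) 1 (c + l))) .at t ⟩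
  evalPoly (flowCountᴾ a c vs) (ℕtoℚ t) ∎
  where
  open ≡-Reasoning
  D = degree vs

-- Every term has nonnegative coefficients and degree at most c + degree vs, and the top term
-- l = degree vs has positive coefficients in all these degrees.
flowCountᴾ-posDeg : ∀ a c vs → PosDeg (c + degree vs) (flowCountᴾ a c vs)
flowCountᴾ-posDeg a c vs = ∑ᴾ-posDeg (suc D) term D (ℕₚ.n<1+n D)
  (λ l l≤D → subst (λ d → NonNegDeg≤ d (term l)) (degrees-add l (ℕₚ.≤-pred l≤D))
     (*ᴾ-nonNegDeg≤ (weightᴾ-nonNegDeg≤ vs l) (posDeg⇒nonNegDeg≤ (compositionsᴾ-posDeg a (c + l)))))
  (const-*ᴾ-posDeg (weightᴾ-top vs) (compositionsᴾ-posDeg a (c + D)))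
  where
  D = degree vs
  term : ℕ → List ℚ
  term l = weightᴾ vs l *ᴾ compositionsᴾ (suc a) 1 (c + l)
  degrees-add : ∀ l → l ≤ D → (D ∸ l) + (c + l) ≡ c + D
  degrees-add l l≤D = trans (ℕₚ.+-comm (D ∸ l) (c + l)) (trans (ℕₚ.+-assoc c l _) (cong (_+_ c) (ℕₚ.m+[n∸m]≡n l≤D)))

flowCount-positivePolynomial : ∀ vs →
  Σ (List ℚ) λ p → All ℚ.Positive p × (λ t → flowCount (scaleNetflows t vs) 0) ≗ᴾ p
flowCount-positivePolynomial [] = 1ℚ ∷ [] , _ ∷ [] , 1≗ᴾ
flowCount-positivePolynomial ((zero , c) ∷ vs) =
  let (p , p-pos , vs≗p) = flowCount-positivePolynomial vs in
  p , p-pos , mk≗ᴾ (λ t → trans (cong ℕtoℚ (first-vertex-idle t)) (vs≗p .at t))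
  where
  first-vertex-idle : ∀ t → flowCount (scaleNetflows t ((zero , c) ∷ vs)) 0 ≡ flowCount (scaleNetflows t vs) 0
  first-vertex-idle t rewrite ℕₚ.*-zeroʳ t | compositions-0 c = ℕₚ.+-identityʳ _
flowCount-positivePolynomial ((suc a , c) ∷ vs) =
  flowCountᴾ a c vs , proj₁ (flowCountᴾ-posDeg a c vs) , flowCount≗flowCountᴾ a c vs

-- Counting by bijections

↔-irrelevant : ∀ {A B : Set} → Irrelevant A → Irrelevant B → (A → B) → (B → A) → A ↔ B
↔-irrelevant irrA irrB f g = mk↔ₛ′ f g (λ _ → irrB _ _) (λ _ → irrA _ _)

Vecℤ-≡-irrelevant : ∀ {k} {u v : Vec ℤ k} → Irrelevant (u ≡ v)
Vecℤ-≡-irrelevant = Decidable⇒UIP.≡-irrelevant (Vecₚ.≡-dec ℤ._≟_)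

Convolution : (ℕ → Set) → (ℕ → Set) → ℕ → Set
Convolution A B M = Σ ℕ λ v → Σ ℕ λ w → (v + w ≡ M) × A w × B v

Convolution-zero : ∀ {A B} → Convolution A B 0 ↔ (A 0 × B 0)
Convolution-zero {A} {B} = mk↔ₛ′ to from (λ _ → refl) from∘to
  where
  to : Convolution A B 0 → A 0 × B 0
  to (zero , zero , refl , a , b) = a , b
  from : A 0 × B 0 → Convolution A B 0
  from (a , b) = 0 , 0 , refl , a , b
  from∘to : ∀ x → from (to x) ≡ x
  from∘to (zero , zero , refl , a , b) = refl

Convolution-suc : ∀ {A B M} → Convolution A B (suc M) ↔ ((A (suc M) × B 0) ⊎ Convolution A (λ v → B (suc v)) M)
Convolution-suc {A} {B} {M} = mk↔ₛ′ to from to∘from from∘to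
  where
  to : Convolution A B (suc M) → (A (suc M) × B 0) ⊎ Convolution A (λ v → B (suc v)) M
  to (zero , w , refl , a , b) = inj₁ (a , b)
  to (suc v , w , e , a , b) = inj₂ (v , w , ℕₚ.suc-injective e , a , b)
  from : (A (suc M) × B 0) ⊎ Convolution A (λ v → B (suc v)) M → Convolution A B (suc M)
  from (inj₁ (a , b)) = zero , suc M , refl , a , b
  from (inj₂ (v , w , e , a , b)) = suc v , w , cong suc e , a , b
  to∘from : ∀ y → to (from y) ≡ y
  to∘from (inj₁ _) = refl
  to∘from (inj₂ (v , w , refl , a , b)) = refl
  from∘to : ∀ x → from (to x) ≡ x
  from∘to (zero , w , refl , a , b) = refl
  from∘to (suc v , w , refl , a , b) = refl

Convolution-↔ : ∀ {A B} f g → (∀ w → A w ↔ Fin (f w)) → (∀ v → B v ↔ Fin (g v)) →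
  ∀ M → Convolution A B M ↔ Fin (conv f g M)
Convolution-↔ f g A↔f B↔g zero =
  ↔-trans Convolution-zero (↔-trans (A↔f 0 ×-↔ B↔g 0) (↔-sym Finₚ.*↔×))
Convolution-↔ f g A↔f B↔g (suc M) =
  ↔-trans Convolution-suc
    (↔-trans (↔-trans (A↔f (suc M) ×-↔ B↔g 0) (↔-sym Finₚ.*↔×) ⊎-↔ Convolution-↔ f (λ v → g (suc v)) A↔f (λ v → B↔g (suc v)) M)
             (↔-sym Finₚ.+↔⊎))

Composition : ℕ → ℕ → Set
Composition c w = Σ (Vec ℕ c) λ g → sum g ≡ w

Composition-zero-↔ : ∀ w → Composition 0 w ↔ Fin (compositions 0 w)
Composition-zero-↔ zero =
  ↔-trans (mk↔ₛ′ (λ _ → tt) (λ _ → [] , refl) (λ _ → refl) (λ { ([] , refl) → refl })) (↔-sym Finₚ.1↔⊤)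
Composition-zero-↔ (suc w) =
  ↔-trans (mk↔ₛ′ (λ { ([] , ()) }) (λ ()) (λ ()) (λ { ([] , ()) })) (↔-sym Finₚ.0↔⊥)

Composition-suc : ∀ c w → Composition (suc c) w ↔ Convolution (λ _ → ⊤) (Composition c) w
Composition-suc c w = mk↔ₛ′ to from to∘from from∘to
  where
  to : Composition (suc c) w → Convolution (λ _ → ⊤) (Composition c) w
  to (x ∷ g , e) = sum g , x , trans (ℕₚ.+-comm (sum g) x) e , tt , g , refl
  from : Convolution (λ _ → ⊤) (Composition c) w → Composition (suc c) w
  from (v , x , e , tt , g , s) = x ∷ g , trans (ℕₚ.+-comm x (sum g)) (trans (cong (_+ x) s) e)
  to∘from : ∀ y → to (from y) ≡ y
  to∘from (v , x , refl , tt , g , refl) = cong (λ e → sum g , x , e , tt , g , refl) (ℕₚ.≡-irrelevant _ _)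
  from∘to : ∀ y → from (to y) ≡ y
  from∘to (x ∷ g , e) = cong (λ e → x ∷ g , e) (ℕₚ.≡-irrelevant _ _)

Composition-↔ : ∀ c w → Composition c w ↔ Fin (compositions c w)
Composition-↔ zero w = Composition-zero-↔ w
Composition-↔ (suc c) w = ↔-trans (Composition-suc c w)
  (subst (λ n → Convolution (λ _ → ⊤) (Composition c) w ↔ Fin n) (conv-1ˡ w (compositions c))
    (Convolution-↔ (λ _ → 1) (compositions c) (λ _ → ↔-sym Finₚ.1↔⊤) (Composition-↔ c) w))

-- Flows on Π

cast-cast-sym : ∀ {A : Set} {m n} (m≡n : m ≡ n) (xs : Vec A n) → cast m≡n (cast (sym m≡n) xs) ≡ xs
cast-cast-sym m≡n xs = trans (Vecₚ.cast-trans (sym m≡n) m≡n xs) (Vecₚ.cast-is-id _ xs)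

Vec-cast-↔ : ∀ {A : Set} {m n} → m ≡ n → Vec A m ↔ Vec A n
Vec-cast-↔ m≡n = mk↔ₛ′ (cast m≡n) (cast (sym m≡n)) (cast-cast-sym m≡n) (cast-cast-sym (sym m≡n))

∷-↔ : ∀ {A : Set} {n} → (A × Vec A n) ↔ Vec A (suc n)
∷-↔ = mk↔ₛ′ (Product.uncurry _∷_) (λ { (x ∷ xs) → x , xs }) (λ { (x ∷ xs) → refl }) (λ _ → refl)

module _ {A : Set} where

  joinFlows : ∀ (E₁ : List A) {E₂} → Vec ℕ (length E₁) → Vec ℕ (length E₂) → Vec ℕ (length (E₁ ++ E₂))
  joinFlows [] [] q = q
  joinFlows (e ∷ E₁) (x ∷ p) q = x ∷ joinFlows E₁ p q

  splitFlows : ∀ (E₁ : List A) {E₂} → Vec ℕ (length (E₁ ++ E₂)) → Vec ℕ (length E₁) × Vec ℕ (length E₂)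
  splitFlows [] f = [] , f
  splitFlows (e ∷ E₁) (x ∷ f) = Product.map₁ (x ∷_) (splitFlows E₁ f)

  ++-flows-↔ : ∀ (E₁ : List A) {E₂} → (Vec ℕ (length E₁) × Vec ℕ (length E₂)) ↔ Vec ℕ (length (E₁ ++ E₂))
  ++-flows-↔ E₁ = mk↔ₛ′ (Product.uncurry (joinFlows E₁)) (splitFlows E₁) (join∘split E₁) (split∘join E₁)
    where
    join∘split : ∀ E₁ {E₂} f → Product.uncurry (joinFlows E₁ {E₂}) (splitFlows E₁ f) ≡ f
    join∘split [] f = refl
    join∘split (e ∷ E₁) (x ∷ f) = cong (x ∷_) (join∘split E₁ f)
    split∘join : ∀ E₁ {E₂} pq → splitFlows E₁ {E₂} (Product.uncurry (joinFlows E₁) pq) ≡ pq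
    split∘join [] ([] , q) = refl
    split∘join (e ∷ E₁) (x ∷ p , q) = cong (Product.map₁ (x ∷_)) (split∘join E₁ (p , q))

edgeFlow : ∀ {v} → Fin v × Fin v → ℕ → Fin v → ℤ
edgeFlow (s , h) x w = (if ⌊ s ≟ w ⌋ then + x else + 0) ℤ.- (if ⌊ h ≟ w ⌋ then + x else + 0)

sucEdge : ∀ {v} → Fin v × Fin v → Fin (suc v) × Fin (suc v)
sucEdge = Product.map suc suc

⌊suc≟suc⌋ : ∀ {v} (s w : Fin v) → ⌊ Fin.suc s ≟ suc w ⌋ ≡ ⌊ s ≟ w ⌋
⌊suc≟suc⌋ s w with s ≟ w
... | yes _ = refl
... | no _ = refl

edgeFlow-suc : ∀ {v} (e : Fin v × Fin v) x w → edgeFlow (sucEdge e) x (suc w) ≡ edgeFlow e x w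
edgeFlow-suc (s , h) x w rewrite ⌊suc≟suc⌋ s w | ⌊suc≟suc⌋ h w = refl

netflow-++ : ∀ {v} (E₁ E₂ : Multigraph v) p q w →
  netflow (E₁ ++ E₂) (joinFlows E₁ p q) w ≡ netflow E₁ p w ℤ.+ netflow E₂ q w
netflow-++ [] E₂ [] q w = sym (ℤₚ.+-identityˡ (netflow E₂ q w))
netflow-++ (e ∷ E₁) E₂ (x ∷ p) q w = trans (cong (ℤ._+_ (edgeFlow e x w)) (netflow-++ E₁ E₂ p q w))
  (sym (ℤₚ.+-assoc (edgeFlow e x w) (netflow E₁ p w) (netflow E₂ q w)))

netflow-map-sucEdge-zero : ∀ {v} (E : Multigraph v) f → netflow (map sucEdge E) f zero ≡ + 0
netflow-map-sucEdge-zero [] [] = refl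
netflow-map-sucEdge-zero (e ∷ E) (x ∷ f) rewrite netflow-map-sucEdge-zero E f = refl

netflow-map-sucEdge-suc : ∀ {v} (E : Multigraph v) f w →
  netflow (map sucEdge E) f (suc w) ≡ netflow E (cast (Listₚ.length-map sucEdge E) f) w
netflow-map-sucEdge-suc [] [] w = refl
netflow-map-sucEdge-suc (e ∷ E) (x ∷ f) w = cong₂ ℤ._+_ (edgeFlow-suc e x w) (netflow-map-sucEdge-suc E f w)

netflow-replicate-tail : ∀ {v} c (h : Fin v) f →
  netflow (replicate c (zero , suc h)) f zero ≡ + sum (cast (Listₚ.length-replicate c) f)
netflow-replicate-tail zero h [] = refl
netflow-replicate-tail (suc c) h (x ∷ f) rewrite netflow-replicate-tail c h f | ℕₚ.+-identityʳ x = refl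

netflow-replicate-elsewhere : ∀ {v} c (h w : Fin v) f → h ≢ w → netflow (replicate c (zero , suc h)) f (suc w) ≡ + 0
netflow-replicate-elsewhere zero h w [] h≢w = refl
netflow-replicate-elsewhere (suc c) h w (x ∷ f) h≢w
  rewrite ⌊suc≟suc⌋ h w | netflow-replicate-elsewhere c h w f h≢w with h ≟ w
... | yes h≡w = ⊥-elim (h≢w h≡w)
... | no _ = refl

pathEdges : (n : ℕ) → Multigraph (suc (suc n))
pathEdges zero = (zero , suc zero) ∷ []
pathEdges (suc n) = (zero , suc zero) ∷ map sucEdge (pathEdges n)

sinkEdges : (n : ℕ) → Vec ℕ (suc n) → Multigraph (suc (suc n))
sinkEdges zero (c ∷ []) = replicate c (zero , suc zero)
sinkEdges (suc n) (c ∷ cs) = replicate c (zero , Fin.fromℕ (suc (suc n))) ++ map sucEdge (sinkEdges n cs)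

pathEdge : ∀ n → Fin (suc n) → Fin (suc (suc n)) × Fin (suc (suc n))
pathEdge n i = inject₁ i , suc i

sinkEdgesAt : ∀ n → Vec ℕ (suc n) → Fin (suc n) → Multigraph (suc (suc n))
sinkEdgesAt n c i = replicate (Vec.lookup c i) (inject₁ i , Fin.fromℕ (suc n))

map-pathEdge : ∀ n → map (pathEdge n) (allFin (suc n)) ≡ pathEdges n
map-pathEdge zero = refl
map-pathEdge (suc n) = cong ((zero , suc zero) ∷_) (begin
  map (pathEdge (suc n)) (tabulate {n = suc n} suc)     ≡⟨ Listₚ.map-tabulate suc (pathEdge (suc n)) ⟩
  tabulate (λ i → sucEdge (pathEdge n i))              ≡⟨ Listₚ.map-tabulate (pathEdge n) sucEdge ⟨
  map sucEdge (tabulate (pathEdge n))                  ≡⟨ cong (map sucEdge) (Listₚ.map-tabulate (λ i → i) (pathEdge n)) ⟨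
  map sucEdge (map (pathEdge n) (allFin (suc n)))      ≡⟨ cong (map sucEdge) (map-pathEdge n) ⟩
  map sucEdge (pathEdges n) ∎)
  where open ≡-Reasoning

concatMap-sinkEdgesAt : ∀ n c → concatMap (sinkEdgesAt n c) (allFin (suc n)) ≡ sinkEdges n c
concatMap-sinkEdgesAt zero (c ∷ []) = Listₚ.++-identityʳ _
concatMap-sinkEdgesAt (suc n) (c ∷ cs) = cong (replicate c (zero , Fin.fromℕ (suc (suc n))) ++_) (begin
  concat (map (sinkEdgesAt (suc n) (c ∷ cs)) (tabulate {n = suc n} suc))
    ≡⟨ cong concat (Listₚ.map-tabulate suc (sinkEdgesAt (suc n) (c ∷ cs))) ⟩
  concat (tabulate (λ i → replicate (Vec.lookup cs i) (sucEdge (inject₁ i , Fin.fromℕ (suc n)))))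
    ≡⟨ cong concat (Listₚ.tabulate-cong (λ i → Listₚ.map-replicate sucEdge (Vec.lookup cs i) (inject₁ i , Fin.fromℕ (suc n)))) ⟨
  concat (tabulate (λ i → map sucEdge (sinkEdgesAt n cs i)))
    ≡⟨ cong concat (Listₚ.map-tabulate (sinkEdgesAt n cs) (map sucEdge)) ⟨
  concat (map (map sucEdge) (tabulate (sinkEdgesAt n cs)))
    ≡⟨ Listₚ.concat-map (tabulate (sinkEdgesAt n cs)) ⟩
  map sucEdge (concat (tabulate (sinkEdgesAt n cs)))
    ≡⟨ cong (λ es → map sucEdge (concat es)) (Listₚ.map-tabulate (λ i → i) (sinkEdgesAt n cs)) ⟨
  map sucEdge (concatMap (sinkEdgesAt n cs) (allFin (suc n)))
    ≡⟨ cong (map sucEdge) (concatMap-sinkEdgesAt n cs) ⟩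
  map sucEdge (sinkEdges n cs) ∎)
  where open ≡-Reasoning

Π≡pathEdges++sinkEdges : ∀ n c → Π n c ≡ pathEdges n ++ sinkEdges n c
Π≡pathEdges++sinkEdges n c = cong₂ _++_ (map-pathEdge n) (concatMap-sinkEdgesAt n c)

vertexData : ∀ {k} → Vec ℕ k → Vec ℕ k → List (ℕ × ℕ)
vertexData [] [] = []
vertexData (a ∷ as) (c ∷ cs) = (a , c) ∷ vertexData as cs

vertexData-scale : ∀ {k} t (a c : Vec ℕ k) → vertexData (scale t a) c ≡ scaleNetflows t (vertexData a c)
vertexData-scale t [] [] = refl
vertexData-scale t (a ∷ as) (c ∷ cs) = cong ((t * a , c) ∷_) (vertexData-scale t as cs)

module LastVertex (b c : ℕ) where

  G : Multigraph 2
  G = pathEdges 0 ++ sinkEdges 0 (c ∷ [])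

  carrier : (ℕ × Vec ℕ c) ↔ Vec ℕ (length G)
  carrier = ↔-trans (↔-refl ×-↔ Vec-cast-↔ (sym (Listₚ.length-replicate c))) ∷-↔

  outflow : ∀ x g → netflow G (Inverse.to carrier (x , g)) zero ≡ + (x + sum g)
  outflow x g = cong₂ ℤ._+_ (ℤₚ.+-identityʳ (+ x))
    (trans (netflow-replicate-tail c zero _) (cong (λ f → + sum f) (cast-cast-sym (Listₚ.length-replicate c) g)))

  condition-↔ : ∀ {y} → (proj₁ y + sum (proj₂ y) ≡ b) ↔
    (Vec.tabulate (λ i → netflow G (Inverse.to carrier y) (inject₁ i)) ≡ Vec.map +_ (b ∷ []))
  condition-↔ {x , g} = ↔-irrelevant ℕₚ.≡-irrelevant Vecℤ-≡-irrelevant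
    (λ x+g≡b → cong (_∷ []) (trans (outflow x g) (cong +_ x+g≡b)))
    (λ flow≡b → ℤₚ.+-injective (trans (sym (outflow x g)) (Vecₚ.∷-injectiveˡ flow≡b)))

  flows-↔ : IntegerFlow 0 G (b ∷ []) ↔ Convolution (Composition c) (λ _ → ⊤) b
  flows-↔ = ↔-trans (↔-sym (Σ-↔ carrier condition-↔)) (mk↔ₛ′ to from to∘from (λ _ → refl))
    where
    to : Σ (ℕ × Vec ℕ c) (λ y → proj₁ y + sum (proj₂ y) ≡ b) → Convolution (Composition c) (λ _ → ⊤) b
    to ((x , g) , e) = x , sum g , e , (g , refl) , tt
    from : Convolution (Composition c) (λ _ → ⊤) b → Σ (ℕ × Vec ℕ c) (λ y → proj₁ y + sum (proj₂ y) ≡ b)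
    from (v , w , e , (g , s) , tt) = (v , g) , trans (cong (_+_ v) s) e
    to∘from : ∀ y → to (from y) ≡ y
    to∘from (v , w , e , (g , refl) , tt) = refl

-- A flow on G₁ consists of the flow x on the first path edge, the flows g on the c₀ sink edges at
-- the first vertex, and a flow h on G₀ whose first vertex receives the extra x units.
module NextVertex (n c₀ : ℕ) (cs : Vec ℕ (suc n)) (b₀ b₁ : ℕ) (bs : Vec ℕ n) where

  P S G₀ : Multigraph (suc (suc n))
  P = pathEdges n
  S = sinkEdges n cs
  G₀ = P ++ S

  R G₁ : Multigraph (suc (suc (suc n)))
  R = replicate c₀ (zero , Fin.fromℕ (suc (suc n)))
  G₁ = pathEdges (suc n) ++ sinkEdges (suc n) (c₀ ∷ cs)

  carrier : (ℕ × Vec ℕ c₀ × Vec ℕ (length G₀)) ↔ Vec ℕ (length G₁)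
  carrier =
    ↔-trans (↔-refl ×-↔ (↔-refl ×-↔ ↔-sym (++-flows-↔ P)))
    (↔-trans (↔-refl ×-↔ reorder)
    (↔-trans (↔-refl ×-↔ (cast-map P ×-↔ (Vec-cast-↔ (sym (Listₚ.length-replicate c₀)) ×-↔ cast-map S)))
    (↔-trans (↔-refl ×-↔ ↔-trans (↔-refl ×-↔ ++-flows-↔ R) (++-flows-↔ (map sucEdge P)))
    ∷-↔)))
    where
    reorder : ∀ {A B C : Set} → (A × (B × C)) ↔ (B × (A × C))
    reorder = mk↔ₛ′ (λ (a , b , c) → b , a , c) (λ (b , a , c) → a , b , c) (λ _ → refl) (λ _ → refl)
    cast-map : ∀ (E : Multigraph (suc (suc n))) → Vec ℕ (length E) ↔ Vec ℕ (length (map sucEdge E))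
    cast-map E = Vec-cast-↔ (sym (Listₚ.length-map sucEdge E))

  assemble : ℕ × Vec ℕ c₀ × Vec ℕ (length G₀) → Vec ℕ (length G₁)
  assemble = Inverse.to carrier

  assemble-netflow : ∀ x g h w → netflow G₁ (assemble (x , g , h)) w ≡ edgeFlow (zero , suc zero) x w ℤ.+
    (netflow (map sucEdge P) (cast (sym (Listₚ.length-map sucEdge P)) (proj₁ (splitFlows P h))) w ℤ.+
     (netflow R (cast (sym (Listₚ.length-replicate c₀)) g) w ℤ.+
      netflow (map sucEdge S) (cast (sym (Listₚ.length-map sucEdge S)) (proj₂ (splitFlows P h))) w))
  assemble-netflow x g h w = cong (ℤ._+_ (edgeFlow (zero , suc zero) x w))
    (trans (netflow-++ (map sucEdge P) (R ++ map sucEdge S) _ _ w)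
           (cong (ℤ._+_ (netflow (map sucEdge P) _ w)) (netflow-++ R (map sucEdge S) _ _ w)))

  outflow : ∀ x g h → netflow G₁ (assemble (x , g , h)) zero ≡ + (x + sum g)
  outflow x g h = trans (assemble-netflow x g h zero) (cong₂ ℤ._+_ (ℤₚ.+-identityʳ (+ x)) (begin
    netflow (map sucEdge P) _ zero ℤ.+ (netflow R g′ zero ℤ.+ netflow (map sucEdge S) _ zero)
      ≡⟨ cong₂ (λ u v → u ℤ.+ (netflow R g′ zero ℤ.+ v)) (netflow-map-sucEdge-zero P _) (netflow-map-sucEdge-zero S _) ⟩
    + 0 ℤ.+ (netflow R g′ zero ℤ.+ + 0)       ≡⟨ trans (ℤₚ.+-identityˡ _) (ℤₚ.+-identityʳ _) ⟩
    netflow R g′ zero                          ≡⟨ netflow-replicate-tail c₀ (Fin.fromℕ (suc n)) g′ ⟩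
    + sum (cast (Listₚ.length-replicate c₀) g′) ≡⟨ cong (λ f → + sum f) (cast-cast-sym (Listₚ.length-replicate c₀) g) ⟩
    + sum g ∎))
    where
    open ≡-Reasoning
    g′ = cast (sym (Listₚ.length-replicate c₀)) g

  inflow : ∀ x g h (i : Fin (suc n)) →
    netflow G₁ (assemble (x , g , h)) (suc (inject₁ i)) ≡ edgeFlow (zero , suc zero) x (suc (inject₁ i)) ℤ.+ netflow G₀ h (inject₁ i)
  inflow x g h i = trans (assemble-netflow x g h (suc w)) (cong (ℤ._+_ (edgeFlow (zero , suc zero) x (suc w))) (begin
    netflow (map sucEdge P) p′ (suc w) ℤ.+ (netflow R g′ (suc w) ℤ.+ netflow (map sucEdge S) q′ (suc w))
      ≡⟨ cong₂ (λ u v → netflow (map sucEdge P) p′ (suc w) ℤ.+ (u ℤ.+ v))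
               (netflow-replicate-elsewhere c₀ (Fin.fromℕ (suc n)) w g′ Finₚ.fromℕ≢inject₁) (netflow-map-sucEdge-suc S q′ w) ⟩
    netflow (map sucEdge P) p′ (suc w) ℤ.+ (+ 0 ℤ.+ netflow S (cast eqS q′) w)
      ≡⟨ cong₂ ℤ._+_ (netflow-map-sucEdge-suc P p′ w) (ℤₚ.+-identityˡ _) ⟩
    netflow P (cast eqP p′) w ℤ.+ netflow S (cast eqS q′) w
      ≡⟨ cong₂ (λ u v → netflow P u w ℤ.+ netflow S v w) (cast-cast-sym eqP p) (cast-cast-sym eqS q) ⟩
    netflow P p w ℤ.+ netflow S q w           ≡⟨ netflow-++ P S p q w ⟨
    netflow G₀ (joinFlows P p q) w            ≡⟨ cong (λ f → netflow G₀ f w) (Inverse.strictlyInverseˡ (++-flows-↔ P) h) ⟩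
    netflow G₀ h w ∎))
    where
    open ≡-Reasoning
    w = inject₁ i
    eqP = Listₚ.length-map sucEdge P
    eqS = Listₚ.length-map sucEdge S
    p = proj₁ (splitFlows P h)
    q = proj₂ (splitFlows P h)
    p′ = cast (sym eqP) p
    q′ = cast (sym eqS) q
    g′ = cast (sym (Listₚ.length-replicate c₀)) g

  Balanced : ℕ × Vec ℕ c₀ × Vec ℕ (length G₀) → Set
  Balanced (x , g , h) = (x + sum g ≡ b₀) × (Vec.tabulate (λ i → netflow G₀ h (inject₁ i)) ≡ Vec.map +_ ((x + b₁) ∷ bs))

  condition-↔ : ∀ {y} → Balanced y ↔ (Vec.tabulate (λ i → netflow G₁ (assemble y) (inject₁ i)) ≡ Vec.map +_ (b₀ ∷ b₁ ∷ bs))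
  condition-↔ {x , g , h} = ↔-irrelevant
    (λ (e₁ , e₂) (e₁′ , e₂′) → cong₂ _,_ (ℕₚ.≡-irrelevant e₁ e₁′) (Vecℤ-≡-irrelevant e₂ e₂′)) Vecℤ-≡-irrelevant
    (λ (x+g≡b₀ , flow₀) → cong₂ _∷_ (trans (outflow x g h) (cong +_ x+g≡b₀))
      (cong₂ _∷_ (trans (inflow x g h zero) (n≡x+b⇒-x+n≡b x _ b₁ (Vecₚ.∷-injectiveˡ flow₀)))
        (trans (Vecₚ.tabulate-cong (λ j → trans (inflow x g h (suc j)) (ℤₚ.+-identityˡ _))) (Vecₚ.∷-injectiveʳ flow₀))))
    (λ flow₁ → ℤₚ.+-injective (trans (sym (outflow x g h)) (Vecₚ.∷-injectiveˡ flow₁)) ,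
      cong₂ _∷_ (-x+n≡b⇒n≡x+b x _ b₁ (trans (sym (inflow x g h zero)) (Vecₚ.∷-injectiveˡ (Vecₚ.∷-injectiveʳ flow₁))))
        (trans (Vecₚ.tabulate-cong (λ j → sym (trans (inflow x g h (suc j)) (ℤₚ.+-identityˡ _))))
               (Vecₚ.∷-injectiveʳ (Vecₚ.∷-injectiveʳ flow₁))))
    where
    open ℤ-Solver.+-*-Solver
    -x+n≡b⇒n≡x+b : ∀ x N b → (+ 0 ℤ.- + x) ℤ.+ N ≡ + b → N ≡ + (x + b)
    -x+n≡b⇒n≡x+b x N b e =
      trans (solve 2 (λ x N → N := x :+ ((con (+ 0) :- x) :+ N)) refl (+ x) N) (cong (ℤ._+_ (+ x)) e)
    n≡x+b⇒-x+n≡b : ∀ x N b → N ≡ + (x + b) → (+ 0 ℤ.- + x) ℤ.+ N ≡ + b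
    n≡x+b⇒-x+n≡b x N b refl = solve 2 (λ x b → (con (+ 0) :- x) :+ (x :+ b) := b) refl (+ x) (+ b)

  flows-↔ : IntegerFlow (suc n) G₁ (b₀ ∷ b₁ ∷ bs) ↔ Convolution (Composition c₀) (λ v → IntegerFlow n G₀ ((v + b₁) ∷ bs)) b₀
  flows-↔ = ↔-trans (↔-sym (Σ-↔ carrier condition-↔)) (mk↔ₛ′ to from to∘from (λ _ → refl))
    where
    to : Σ _ Balanced → Convolution (Composition c₀) (λ v → IntegerFlow n G₀ ((v + b₁) ∷ bs)) b₀
    to ((x , g , h) , e₁ , e₂) = x , sum g , e₁ , (g , refl) , (h , e₂)
    from : Convolution (Composition c₀) (λ v → IntegerFlow n G₀ ((v + b₁) ∷ bs)) b₀ → Σ _ Balanced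
    from (v , w , e , (g , s) , (h , e₂)) = (v , g , h) , trans (cong (_+_ v) s) e , e₂
    to∘from : ∀ y → to (from y) ≡ y
    to∘from (v , w , e , (g , refl) , (h , e₂)) = refl

flows-↔-flowCount : ∀ n (b c : Vec ℕ (suc n)) →
  IntegerFlow n (pathEdges n ++ sinkEdges n c) b ↔ Fin (flowCount (vertexData b c) 0)
flows-↔-flowCount zero (b ∷ []) (c ∷ []) =
  ↔-trans (LastVertex.flows-↔ b c) (Convolution-↔ (compositions c) (λ _ → 1) (Composition-↔ c) (λ _ → ↔-sym Finₚ.1↔⊤) b)
flows-↔-flowCount (suc n) (b₀ ∷ b₁ ∷ bs) (c₀ ∷ c₁ ∷ cs) =
  ↔-trans (NextVertex.flows-↔ n c₀ (c₁ ∷ cs) b₀ b₁ bs)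
    (Convolution-↔ (compositions c₀) (flowCount (vertexData (b₁ ∷ bs) (c₁ ∷ cs))) (Composition-↔ c₀)
      (λ v → flows-↔-flowCount n ((v + b₁) ∷ bs) (c₁ ∷ cs)) b₀)

corollary6p20 : (n : ℕ) (a c : Vec ℕ (suc n)) →
    Σ (List ℚ) λ coeffs → All (λ q → 0ℚ < q) coeffs ×
      ((t : ℕ) → Σ ℕ λ K →
        HasCard (IntegerFlow n (Π n c) (scale t a)) K × (ℕtoℚ K ≡ evalPoly coeffs (ℕtoℚ t)))
corollary6p20 n a c with flowCount-positivePolynomial (vertexData a c)
... | p , p-pos , count≗p = p , All.map (λ {q} q-pos → ℚₚ.positive⁻¹ q {{q-pos}}) p-pos , λ t → K t , card t , K≡p t
  where
  K : ℕ → ℕ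
  K t = flowCount (vertexData (scale t a) c) 0
  card : ∀ t → HasCard (IntegerFlow n (Π n c) (scale t a)) (K t)
  card t = subst (λ G → HasCard (IntegerFlow n G (scale t a)) (K t)) (sym (Π≡pathEdges++sinkEdges n c))
    (flows-↔-flowCount n (scale t a) c)
  K≡p : ∀ t → ℕtoℚ (K t) ≡ evalPoly p (ℕtoℚ t)
  K≡p t = trans (cong (λ vs → ℕtoℚ (flowCount vs 0)) (vertexData-scale t a c)) (count≗p .at t)
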